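{- Let $G$ be a graph of minimum degree at least $2$ and let $\Omega$ be a total $2$-coalition partition of $G$. Then (i) $\Delta(\mathrm{TC}_2G(G,\Omega))\le \Delta(G)-1$, and (ii) $\beta(\mathrm{TC}_2G(G,\Omega))\le \delta(G)-1$.
   Context: All graphs are finite, simple and connected; $\delta$ and $\Delta$ denote minimum and maximum degree, and $\beta(H)$ denotes the vertex cover number of a graph $H$. For a vertex $v$, $N(v)$ denotes its open neighborhood. A set $S\subseteq V(G)$ is a total $2$-dominating set if $|N(v)\cap S|\ge 2$ for every $v\in V(G)$. Two disjoint sets $U,W\subseteq V(G)$ form a total $2$-coalition if neither is a total $2$-dominating set but $U\cup W$ is. A total $2$-coalition partition of $G$ is a partition $\Omega$ of $V(G)$ such that every set of $\Omega$ forms a total $2$-coalition with some other set of $\Omega$. The total $2$-coalition graph $\mathrm{TC}_2G(G,\Omega)$ has vertex set $\Omega$, two sets being adjacent iff they form a total $2$-coalition in $G$. -}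

module Defs where

open import Data.Nat using (ℕ; zero; suc; _≤_; _⊔_; _⊓_)
open import Data.Bool using (Bool; true; false)
open import Data.Fin using (Fin; zero; suc; _≟_)
open import Data.Fin.Subset using (Subset; _∈_; _∩_; _∪_; ∣_∣)
open import Data.Vec using (tabulate)
import Data.List as List
open import Data.Product using (Σ; ∃; _×_; _,_)
open import Relation.Nullary using (¬_; Dec; ⌊_⌋)
open import Relation.Binary.PropositionalEquality using (_≡_; _≢_)
open import Data.Nat using (_≤?_)
open import Data.Fin.Properties using (all?)
open import Data.Fin.Subset.Properties using (_∈?_)
open import Data.Sum using (_⊎_)
open import Relation.Nullary using (¬?; _×-dec_; _→-dec_)

record Graph (n : ℕ) : Set where
  field
    adj   : Fin n → Fin n → Bool
    sym   : ∀ u v → adj u v ≡ adj v u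
    irrefl : ∀ v → adj v v ≡ false

open Graph public

module _ {n : ℕ} (G : Graph n) where

  N : Fin n → Subset n
  N v = tabulate (adj G v)

  deg : Fin n → ℕ
  deg v = ∣ N v ∣

  data Reachable : Fin n → Fin n → Set where
    here : ∀ {v} → Reachable v v
    step : ∀ {u v w} → adj G u v ≡ true → Reachable v w → Reachable u w

  Connected : Set
  Connected = ∀ u v → Reachable u v

  IsTotal2Dominating : Subset n → Set
  IsTotal2Dominating S = ∀ v → 2 ≤ ∣ N v ∩ S ∣

  Disjoint : Subset n → Subset n → Set
  Disjoint U W = ∀ v → v ∈ U → v ∈ W → ⊥′
    where open import Data.Empty renaming (⊥ to ⊥′)

  Total2Coalition : Subset n → Subset n → Set
  Total2Coalition U W =
    Disjoint U W × ¬ IsTotal2Dominating U × ¬ IsTotal2Dominating W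
    × IsTotal2Dominating (U ∪ W)

maxDeg : ∀ {m} → Graph (suc m) → ℕ
maxDeg G = List.foldr _⊔_ (deg G zero) (List.tabulate (λ v → deg G (suc v)))

minDeg : ∀ {m} → Graph (suc m) → ℕ
minDeg G = List.foldr _⊓_ (deg G zero) (List.tabulate (λ v → deg G (suc v)))

record Partition (n k : ℕ) : Set where
  field
    part : Fin n → Fin k
    nonempty : ∀ i → ∃ λ v → part v ≡ i

open Partition public

cls : ∀ {n k} → Partition n k → Fin k → Subset n
cls P i = tabulate (λ v → ⌊ part P v ≟ i ⌋)

-- two classes are adjacent in TC_2G(G, Ω)
TCAdj : ∀ {n k} → Graph n → Partition n k → Fin k → Fin k → Set
TCAdj G P i j = Total2Coalition G (cls P i) (cls P j)

IsTotal2CoalitionPartition : ∀ {n k} → Graph n → Partition n k → Set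
IsTotal2CoalitionPartition G P = ∀ i → ∃ λ j → TCAdj G P i j

module _ {n : ℕ} (G : Graph n) where
  isTotal2Dominating? : ∀ S → Dec (IsTotal2Dominating G S)
  isTotal2Dominating? S = all? (λ v → 2 ≤? ∣ N G v ∩ S ∣)

  disjoint? : ∀ U W → Dec (Disjoint G U W)
  disjoint? U W = all? (λ v → (v ∈? U) →-dec ((v ∈? W) →-dec (no (λ ()))))
    where open import Relation.Nullary using (no)

  total2Coalition? : ∀ U W → Dec (Total2Coalition G U W)
  total2Coalition? U W = disjoint? U W ×-dec ¬? (isTotal2Dominating? U)
    ×-dec ¬? (isTotal2Dominating? W) ×-dec isTotal2Dominating? (U ∪ W)

tcN : ∀ {n k} → Graph n → Partition n k → Fin k → Subset k
tcN G P i = tabulate (λ j → ⌊ total2Coalition? G (cls P i) (cls P j) ⌋)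

tcDeg : ∀ {n k} → Graph n → Partition n k → Fin k → ℕ
tcDeg G P i = ∣ tcN G P i ∣

-- maximum degree of TC_2G(G, Ω) (k ≥ 1 since V(G) is nonempty)
tcMaxDeg : ∀ {n k} → Graph n → Partition n (suc k) → ℕ
tcMaxDeg G P = List.foldr _⊔_ (tcDeg G P zero) (List.tabulate (λ i → tcDeg G P (suc i)))

IsTCVertexCover : ∀ {n k} → Graph n → Partition n k → Subset k → Set
IsTCVertexCover G P C = ∀ i j → TCAdj G P i j → i ∈ C ⊎ j ∈ C

-- A class U of Ω with a coalition partner is not total 2-dominating, so some vertex v has at
-- most one neighbour w in U (if it has none, let w be any neighbour).  For every partner W of U,
-- v has two neighbours in U ∪ W, hence one other than w, and that one lies in W.  So all partners
-- of U are classes met by N(v) − w, and deg U ≤ deg v − 1 ≤ Δ − 1.  Likewise, if v has minimum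
-- degree and u ∈ N(v), every coalition U ∪ W contains a vertex of N(v) − u, so the at most δ − 1
-- classes meeting N(v) − u cover all edges.
module Submission where

open import Defs
open import Data.Nat using (ℕ; suc; _≤_; _∸_)
open import Data.Fin.Subset using (Subset; ∣_∣)
open import Data.Product using (Σ; _×_)

open import Data.Nat using (zero; _+_; _<_; _≤?_; z≤n; s≤s)
open import Data.Nat.Properties
  using ( ≤-refl; ≤-reflexive; ≤-trans; ≤-<-trans; <-≤-trans; ≤⇒≯; ≰⇒>; n≤1+n; <⇒≤pred
        ; +-suc; +-comm; +-monoʳ-≤; ∸-monoˡ-≤; ⊔-lub; ⊓-sel; m≤n⇒m≤n⊔o; m≤n⇒m≤o⊔n; module ≤-Reasoning)
open import Data.Fin using (Fin; zero; suc) renaming (_≟_ to _≟ᶠ_)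
open import Data.Fin.Properties using (any?; ¬∀⟶∃¬; ¬Fin0)
open import Data.Fin.Subset using (_∈_; _∉_; _⊆_; _∩_; _∪_; _─_; _-_; ⁅_⁆; Nonempty; Empty; inside; outside)
open import Data.Fin.Subset.Properties
  using ( _∈?_; nonempty?; Empty-unique; ∣⊥∣≡0; ∣⁅x⁆∣≡1; x∈⁅x⁆; x∈⁅y⁆⇒x≡y; p─q⊆p
        ; x∈p∩q⁺; x∈p∩q⁻; x∈p∪q⁻; x∈p∧x≢y⇒x∈p-y; x∈p⇒∣p-x∣<∣p∣; p⊆q⇒∣p∣≤∣q∣; ∣p∩q∣≤∣p∣)
open import Data.Vec using (_∷_; []; tabulate; here; there)
open import Data.Vec.Properties using (lookup∘tabulate; []=⇒lookup; lookup⇒[]=)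
import Data.List as List
open import Data.List.Properties using (foldr-preservesᵇ; foldr-preservesᵒ)
open import Data.List.Membership.Propositional.Properties using (foldr-selective; ∈-tabulate⁻)
import Data.List.Relation.Unary.All.Properties as All
import Data.List.Relation.Unary.Any.Properties as Any
open import Data.List.Relation.Unary.Any using (Any)
open import Data.Product using (∃; _,_; proj₁)
open import Data.Sum using (_⊎_; inj₁; inj₂; [_,_])
open import Data.Empty using (⊥-elim)
open import Level using (Level)
open import Relation.Nullary using (¬_; ¬?; yes; no; ⌊_⌋; _×-dec_)
open import Relation.Nullary.Decidable using (dec-true; isYes≗does)
open import Relation.Unary using (Pred; Decidable)
open import Relation.Binary.PropositionalEquality using (_≡_; _≢_; refl; trans; subst)
import Relation.Binary.PropositionalEquality as ≡

private
  variable
    ℓ : Level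
    n k : ℕ

Empty⇒∣p∣≡0 : {p : Subset n} → Empty p → ∣ p ∣ ≡ 0
Empty⇒∣p∣≡0 {n} ∅ rewrite Empty-unique ∅ = ∣⊥∣≡0 n

0<∣p∣⇒Nonempty : (p : Subset n) → 0 < ∣ p ∣ → Nonempty p
0<∣p∣⇒Nonempty p 0<∣p∣ with nonempty? p
... | yes ne = ne
... | no ∅ with () ← subst (0 <_) (Empty⇒∣p∣≡0 ∅) 0<∣p∣

x∈p⇒0<∣p∣ : {p : Subset n} {x : Fin n} → x ∈ p → 0 < ∣ p ∣
x∈p⇒0<∣p∣ {p = p} {x} x∈p = subst (_≤ ∣ p ∣) (∣⁅x⁆∣≡1 x) (p⊆q⇒∣p∣≤∣q∣ ⁅x⁆⊆p)
  where
  ⁅x⁆⊆p : ⁅ x ⁆ ⊆ p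
  ⁅x⁆⊆p y∈⁅x⁆ = subst (_∈ p) (≡.sym (x∈⁅y⁆⇒x≡y x y∈⁅x⁆)) x∈p

x∈p─q⇒x∉q : {p q : Subset n} {x : Fin n} → x ∈ p ─ q → x ∉ q
x∈p─q⇒x∉q {p = inside ∷ p} {outside ∷ q} here ()
x∈p─q⇒x∉q {p = _ ∷ p} {_ ∷ q} (there x∈p─q) (there x∈q) = x∈p─q⇒x∉q x∈p─q x∈q

∣p∣≤∣p─q∣+∣q∣ : (p q : Subset n) → ∣ p ∣ ≤ ∣ p ─ q ∣ + ∣ q ∣
∣p∣≤∣p─q∣+∣q∣ []            []            = z≤n
∣p∣≤∣p─q∣+∣q∣ (inside  ∷ p) (inside  ∷ q) =
  ≤-trans (s≤s (∣p∣≤∣p─q∣+∣q∣ p q)) (≤-reflexive (≡.sym (+-suc ∣ p ─ q ∣ ∣ q ∣)))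
∣p∣≤∣p─q∣+∣q∣ (inside  ∷ p) (outside ∷ q) = s≤s (∣p∣≤∣p─q∣+∣q∣ p q)
∣p∣≤∣p─q∣+∣q∣ (outside ∷ p) (inside  ∷ q) =
  ≤-trans (∣p∣≤∣p─q∣+∣q∣ p q) (+-monoʳ-≤ ∣ p ─ q ∣ (n≤1+n ∣ q ∣))
∣p∣≤∣p─q∣+∣q∣ (outside ∷ p) (outside ∷ q) = ∣p∣≤∣p─q∣+∣q∣ p q

2≤∣p∣⇒∃≢ : {p : Subset n} → 2 ≤ ∣ p ∣ → (y : Fin n) → ∃ λ x → x ∈ p × x ≢ y
2≤∣p∣⇒∃≢ {p = p} 2≤∣p∣ y with any? (λ x → x ∈? p ×-dec ¬? (x ≟ᶠ y))
... | yes other = other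
... | no ¬other = ⊥-elim (≤⇒≯ ∣p∣≤1 2≤∣p∣)
  where
  p⊆⁅y⁆ : p ⊆ ⁅ y ⁆
  p⊆⁅y⁆ {x} x∈p with x ≟ᶠ y
  ... | yes refl = x∈⁅x⁆ x
  ... | no x≢y   = ⊥-elim (¬other (x , x∈p , x≢y))
  ∣p∣≤1 : ∣ p ∣ ≤ 1
  ∣p∣≤1 = subst (∣ p ∣ ≤_) (∣⁅x⁆∣≡1 y) (p⊆q⇒∣p∣≤∣q∣ p⊆⁅y⁆)

∣p∣≤1⇒p⊆⁅x⁆ : {p : Subset n} {x : Fin n} → ∣ p ∣ ≤ 1 → x ∈ p → p ⊆ ⁅ x ⁆
∣p∣≤1⇒p⊆⁅x⁆ {x = x} ∣p∣≤1 x∈p {z} z∈p with z ≟ᶠ x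
... | yes refl = x∈⁅x⁆ x
... | no z≢x   = ⊥-elim (≤⇒≯ ∣p∣≤1 (<-≤-trans (s≤s (x∈p⇒0<∣p∣ z∈p-x)) (x∈p⇒∣p-x∣<∣p∣ x∈p)))
  where z∈p-x = x∈p∧x≢y⇒x∈p-y z∈p z≢x

∣p∩q∣≤1⇒∃⊆⁅⁆ : (p q : Subset n) → Nonempty p → ∣ p ∩ q ∣ ≤ 1 →
               ∃ λ w → w ∈ p × p ∩ q ⊆ ⁅ w ⁆
∣p∩q∣≤1⇒∃⊆⁅⁆ p q (x , x∈p) ∣p∩q∣≤1 with nonempty? (p ∩ q)
... | yes (w , w∈p∩q) = w , proj₁ (x∈p∩q⁻ p q w∈p∩q) , ∣p∣≤1⇒p⊆⁅x⁆ ∣p∩q∣≤1 w∈p∩q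
... | no ∅            = x , x∈p , λ z∈p∩q → ⊥-elim (∅ (_ , z∈p∩q))

covered⇒∣q∣≤∣p∣ : (f : Fin n → Fin k) (p : Subset n) (q : Subset k) →
                  (∀ {y} → y ∈ q → ∃ λ x → x ∈ p × f x ≡ y) → ∣ q ∣ ≤ ∣ p ∣
covered⇒∣q∣≤∣p∣ f [] q covered = subst (_≤ 0) (≡.sym (Empty⇒∣p∣≡0 q≡∅)) z≤n
  where
  q≡∅ : Empty q
  q≡∅ (_ , y∈q) = ¬Fin0 (proj₁ (covered y∈q))
covered⇒∣q∣≤∣p∣ f (outside ∷ p) q covered = covered⇒∣q∣≤∣p∣ (λ x → f (suc x)) p q covered′
  where
  covered′ : ∀ {y} → y ∈ q → ∃ λ x → x ∈ p × f (suc x) ≡ y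
  covered′ y∈q with covered y∈q
  ... | suc x , there x∈p , fx≡y = x , x∈p , fx≡y
covered⇒∣q∣≤∣p∣ f (inside ∷ p) q covered =
  begin
    ∣ q ∣                         ≤⟨ ∣p∣≤∣p─q∣+∣q∣ q ⁅ f zero ⁆ ⟩
    ∣ q - f zero ∣ + ∣ ⁅ f zero ⁆ ∣ ≡⟨ ≡.cong (∣ q - f zero ∣ +_) (∣⁅x⁆∣≡1 (f zero)) ⟩
    ∣ q - f zero ∣ + 1             ≡⟨ +-comm ∣ q - f zero ∣ 1 ⟩
    suc ∣ q - f zero ∣             ≤⟨ s≤s (covered⇒∣q∣≤∣p∣ (λ x → f (suc x)) p (q - f zero) covered′) ⟩
    suc ∣ p ∣                      ∎
  where
  open ≤-Reasoning
  covered′ : ∀ {y} → y ∈ q - f zero → ∃ λ x → x ∈ p × f (suc x) ≡ y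
  covered′ {y} y∈q-f0 with covered (p─q⊆p q ⁅ f zero ⁆ y∈q-f0)
  ... | zero  , _         , refl = ⊥-elim (x∈p─q⇒x∉q y∈q-f0 (x∈⁅x⁆ y))
  ... | suc x , there x∈p , fx≡y = x , x∈p , fx≡y

∈-tabulate-⌊⌋⁻ : {P : Pred (Fin n) ℓ} (P? : Decidable P) {x : Fin n} →
                   x ∈ tabulate (λ y → ⌊ P? y ⌋) → P x
∈-tabulate-⌊⌋⁻ P? {x} x∈ with P? x | trans (≡.sym (lookup∘tabulate _ x)) ([]=⇒lookup x∈)
... | yes Px | _ = Px

∈-tabulate-⌊⌋⁺ : {P : Pred (Fin n) ℓ} (P? : Decidable P) {x : Fin n} →
                   P x → x ∈ tabulate (λ y → ⌊ P? y ⌋)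
∈-tabulate-⌊⌋⁺ P? {x} Px =
  lookup⇒[]= x _ (trans (lookup∘tabulate _ x) (trans (isYes≗does (P? x)) (dec-true (P? x) Px)))

image : (Fin n → Fin k) → Subset n → Subset k
image f p = tabulate (λ y → ⌊ any? (λ x → x ∈? p ×-dec f x ≟ᶠ y) ⌋)

∈-image⁺ : (f : Fin n → Fin k) {p : Subset n} {x : Fin n} → x ∈ p → f x ∈ image f p
∈-image⁺ f {p} {x} x∈p = ∈-tabulate-⌊⌋⁺ (λ y → any? (λ x → x ∈? p ×-dec f x ≟ᶠ y)) (x , x∈p , refl)

∣image∣≤∣p∣ : (f : Fin n → Fin k) (p : Subset n) → ∣ image f p ∣ ≤ ∣ p ∣
∣image∣≤∣p∣ f p = covered⇒∣q∣≤∣p∣ f p (image f p)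
  (∈-tabulate-⌊⌋⁻ (λ y → any? (λ x → x ∈? p ×-dec f x ≟ᶠ y)))

∣image[p-x]∣≤∣p∣∸1 : (f : Fin n → Fin k) {p : Subset n} {x : Fin n} → x ∈ p →
                     ∣ image f (p - x) ∣ ≤ ∣ p ∣ ∸ 1
∣image[p-x]∣≤∣p∣∸1 f {p} {x} x∈p = <⇒≤pred (≤-<-trans (∣image∣≤∣p∣ f (p - x)) (x∈p⇒∣p-x∣<∣p∣ x∈p))

2≤∣p∩[q∪r]∣⇒∃≢ : {p q r : Subset n} → 2 ≤ ∣ p ∩ (q ∪ r) ∣ → (y : Fin n) →
                 ∃ λ x → x ∈ p × x ≢ y × (x ∈ q ⊎ x ∈ r)
2≤∣p∩[q∪r]∣⇒∃≢ {p = p} {q} {r} 2≤∣p∩[q∪r]∣ y with 2≤∣p∣⇒∃≢ 2≤∣p∩[q∪r]∣ y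
... | x , x∈p∩[q∪r] , x≢y with x∈p∩q⁻ p (q ∪ r) x∈p∩[q∪r]
... | x∈p , x∈q∪r = x , x∈p , x≢y , x∈p∪q⁻ q r x∈q∪r

deg≤maxDeg : ∀ {m} (G : Graph (suc m)) (v : Fin (suc m)) → deg G v ≤ maxDeg G
deg≤maxDeg G v = foldr-preservesᵒ (λ x y → [ m≤n⇒m≤n⊔o y , m≤n⇒m≤o⊔n x ]) _ _ (listed v)
  where
  listed : ∀ v → deg G v ≤ deg G zero ⊎ Any (deg G v ≤_) (List.tabulate (λ u → deg G (suc u)))
  listed zero    = inj₁ ≤-refl
  listed (suc v) = inj₂ (Any.tabulate⁺ v ≤-refl)

minDeg-attained : ∀ {m} (G : Graph (suc m)) → ∃ λ v → deg G v ≡ minDeg G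
minDeg-attained G with foldr-selective ⊓-sel (deg G zero) (List.tabulate (λ v → deg G (suc v)))
... | inj₁ δ≡deg₀ = zero , ≡.sym δ≡deg₀
... | inj₂ δ∈     with ∈-tabulate⁻ δ∈
...   | v , δ≡deg = suc v , ≡.sym δ≡deg

tcMaxDeg≤ : ∀ {m k} (G : Graph m) (Ω : Partition m (suc k)) {b : ℕ} →
            (∀ i → tcDeg G Ω i ≤ b) → tcMaxDeg G Ω ≤ b
tcMaxDeg≤ G Ω {b} bound =
  foldr-preservesᵇ {P = _≤ b} ⊔-lub (bound zero) (All.tabulate⁺ (λ i → bound (suc i)))

module _ (G : Graph n) where

  ¬IsTotal2Dominating⇒∃∣N∩S∣≤1 : {S : Subset n} → ¬ IsTotal2Dominating G S →
                                 ∃ λ v → ∣ N G v ∩ S ∣ ≤ 1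
  ¬IsTotal2Dominating⇒∃∣N∩S∣≤1 {S} ¬dom with ¬∀⟶∃¬ n _ (λ v → 2 ≤? ∣ N G v ∩ S ∣) ¬dom
  ... | v , ≰ = v , <⇒≤pred (≰⇒> ≰)

  module _ (Ω : Partition n k) where

    ∈cls⇒part≡ : {i : Fin k} {z : Fin n} → z ∈ cls Ω i → part Ω z ≡ i
    ∈cls⇒part≡ {i} = ∈-tabulate-⌊⌋⁻ (λ v → part Ω v ≟ᶠ i)

    ∈tcN⇒TCAdj : {i j : Fin k} → j ∈ tcN G Ω i → TCAdj G Ω i j
    ∈tcN⇒TCAdj {i} = ∈-tabulate-⌊⌋⁻ (λ j → total2Coalition? G (cls Ω i) (cls Ω j))

    TCAdj⇒dominated : {i j : Fin k} → TCAdj G Ω i j → ∀ v → 2 ≤ ∣ N G v ∩ (cls Ω i ∪ cls Ω j) ∣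
    TCAdj⇒dominated (_ , _ , _ , dominating) = dominating

    ∈image-part : {A : Subset n} {z : Fin n} {i : Fin k} → z ∈ A → z ∈ cls Ω i → i ∈ image (part Ω) A
    ∈image-part {A} z∈A z∈Uᵢ = subst (_∈ image (part Ω) A) (∈cls⇒part≡ z∈Uᵢ) (∈-image⁺ (part Ω) z∈A)

    image-part-covers : (v w : Fin n) → IsTCVertexCover G Ω (image (part Ω) (N G v - w))
    image-part-covers v w i j coalition with 2≤∣p∩[q∪r]∣⇒∃≢ (TCAdj⇒dominated coalition v) w
    ... | z , z∈N , z≢w , inj₁ z∈Uᵢ = inj₁ (∈image-part (x∈p∧x≢y⇒x∈p-y z∈N z≢w) z∈Uᵢ)
    ... | z , z∈N , z≢w , inj₂ z∈Uⱼ = inj₂ (∈image-part (x∈p∧x≢y⇒x∈p-y z∈N z≢w) z∈Uⱼ)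

    partners⊆image-part : {i : Fin k} {v w : Fin n} → N G v ∩ cls Ω i ⊆ ⁅ w ⁆ →
                          tcN G Ω i ⊆ image (part Ω) (N G v - w)
    partners⊆image-part {i} {v} {w} N∩Uᵢ⊆⁅w⁆ j∈tcN
      with 2≤∣p∩[q∪r]∣⇒∃≢ (TCAdj⇒dominated (∈tcN⇒TCAdj j∈tcN) v) w
    ... | z , z∈N , z≢w , inj₁ z∈Uᵢ = ⊥-elim (z≢w (x∈⁅y⁆⇒x≡y w (N∩Uᵢ⊆⁅w⁆ (x∈p∩q⁺ (z∈N , z∈Uᵢ)))))
    ... | z , z∈N , z≢w , inj₂ z∈Uⱼ = ∈image-part (x∈p∧x≢y⇒x∈p-y z∈N z≢w) z∈Uⱼ

    TCAdj⇒Nonempty-N : {i j : Fin k} → TCAdj G Ω i j → ∀ v → Nonempty (N G v)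
    TCAdj⇒Nonempty-N coalition v = 0<∣p∣⇒Nonempty (N G v)
      (≤-trans (s≤s z≤n) (≤-trans (TCAdj⇒dominated coalition v) (∣p∩q∣≤∣p∣ (N G v) _)))

    TCAdj⇒∃tcDeg≤deg∸1 : {i j : Fin k} → TCAdj G Ω i j → ∃ λ v → tcDeg G Ω i ≤ deg G v ∸ 1
    TCAdj⇒∃tcDeg≤deg∸1 {i} coalition@(_ , ¬domᵢ , _) with ¬IsTotal2Dominating⇒∃∣N∩S∣≤1 ¬domᵢ
    ... | v , ∣N∩Uᵢ∣≤1 with ∣p∩q∣≤1⇒∃⊆⁅⁆ (N G v) (cls Ω i) (TCAdj⇒Nonempty-N coalition v) ∣N∩Uᵢ∣≤1
    ... | w , w∈N , N∩Uᵢ⊆⁅w⁆ =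
      v , ≤-trans (p⊆q⇒∣p∣≤∣q∣ (partners⊆image-part N∩Uᵢ⊆⁅w⁆)) (∣image[p-x]∣≤∣p∣∸1 (part Ω) w∈N)

module _ {m} (G : Graph (suc m)) (Ω : Partition (suc m) k) where

  tcDeg≤maxDeg∸1 : (i : Fin k) → tcDeg G Ω i ≤ maxDeg G ∸ 1
  tcDeg≤maxDeg∸1 i with nonempty? (tcN G Ω i)
  ... | no ∅ = subst (_≤ maxDeg G ∸ 1) (≡.sym (Empty⇒∣p∣≡0 ∅)) z≤n
  ... | yes (j , j∈tcN) =
    let v , tcDeg≤deg∸1 = TCAdj⇒∃tcDeg≤deg∸1 G Ω (∈tcN⇒TCAdj G Ω j∈tcN)
    in ≤-trans tcDeg≤deg∸1 (∸-monoˡ-≤ 1 (deg≤maxDeg G v))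

  tcVertexCover≤minDeg∸1 : 0 < minDeg G →
                           Σ (Subset k) λ C → IsTCVertexCover G Ω C × ∣ C ∣ ≤ minDeg G ∸ 1
  tcVertexCover≤minDeg∸1 0<δ with minDeg-attained G
  ... | v , deg≡δ with 0<∣p∣⇒Nonempty (N G v) (subst (0 <_) (≡.sym deg≡δ) 0<δ)
  ...   | u , u∈N = image (part Ω) (N G v - u)
                  , image-part-covers G Ω v u
                  , subst (λ d → ∣ image (part Ω) (N G v - u) ∣ ≤ d ∸ 1) deg≡δ
                          (∣image[p-x]∣≤∣p∣∸1 (part Ω) u∈N)

lemma3p4 : ∀ {m k} (G : Graph (suc m)) → Connected G → 2 ≤ minDeg G
           → (Ω : Partition (suc m) (suc k)) → IsTotal2CoalitionPartition G Ω
           → (tcMaxDeg G Ω ≤ maxDeg G ∸ 1)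
             × Σ (Subset (suc k)) (λ C → IsTCVertexCover G Ω C × ∣ C ∣ ≤ minDeg G ∸ 1)
lemma3p4 G _ 2≤δ Ω _ =
  tcMaxDeg≤ G Ω (tcDeg≤maxDeg∸1 G Ω) , tcVertexCover≤minDeg∸1 G Ω (≤-trans (s≤s z≤n) 2≤δ)
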